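{- Let $\rho,\sigma,k,l,\mu$ be positive integers with $\mu>1$, and let $\mathcal C$ be a configuration of type $(\rho\mu_k,\sigma\mu_l)$. Then $\mathcal C$ is polycyclic with respect to $\mu$ (i.e. $\mathcal C$ admits an automorphism of order $\mu$ whose orbits partition both the point set and the line set into subsets of size $\mu$) if and only if $\mathcal C$ admits an incidence matrix (for a suitable ordering of its points and lines) which is the blow-up $\overline{M^{(\mu)}}$ of a $\mathbb{Z}_\mu$-scheme $M^{(\mu)}$ of order $(\rho,\sigma)$ and valency $(k,l)$.
   Context: A configuration of type $(m_k,n_l)$ is an incidence structure of $m$ points and $n$ lines whose incidence matrix (rows = points, columns = lines) is a $J_2$-free $(0,1)$-matrix of order $(m,n)$ with all row sums $k$ and all column sums $l$; $J_2$-free means every $2\times 2$ submatrix (two distinct rows, two distinct columns) contains an entry $0$. An automorphism is a pair of permutations of points and lines preserving incidence. A $\mathbb{Z}_\mu$-scheme of order $(\rho,\sigma)$ is a $\rho\times\sigma$ array $(S_{ij})$ of subsets of $\mathbb{Z}_\mu$; it has valency $(k,l)$ if $\sum_j|S_{ij}|=k$ for each row $i$ and $\sum_i |S_{ij}|=l$ for each column $j$. For $C\subseteq\mathbb{Z}_\mu$, $\overline C$ is the circulant $(0,1)$-matrix of order $\mu$ (indices $0,\dots,\mu-1$) with entry $1$ at $(i,j)$ iff $j-i\pmod\mu\in C$; the blow-up $\overline{M^{(\mu)}}$ is the $\rho\mu\times\sigma\mu$ block matrix with blocks $\overline{S_{ij}}$. -}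

module Defs where

open import Data.Nat using (ℕ; _+_; _*_; _∸_; _<_)
open import Data.Nat.DivMod using (_%_; m%n<n)
open import Data.Bool using (Bool; true; false; if_then_else_)
open import Data.Fin using (Fin; zero; suc; toℕ; fromℕ<; remQuot)
open import Data.Fin.Subset using (Subset; ∣_∣)
open import Data.Fin.Permutation using (Permutation′; _⟨$⟩ʳ_)
open import Data.Vec using (lookup)
open import Data.Product using (_×_; Σ; proj₁; proj₂)
open import Relation.Binary.PropositionalEquality using (_≡_; _≢_)
open import Relation.Nullary using (¬_)

sumFin : ∀ {n} → (Fin n → ℕ) → ℕ
sumFin {ℕ.zero}  f = 0
sumFin {ℕ.suc n} f = f zero + sumFin (λ i → f (suc i))

b2n : Bool → ℕ
b2n true  = 1
b2n false = 0

-- (0,1)-matrix with rows Fin m (points) and columns Fin n (lines)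
Matrix01 : ℕ → ℕ → Set
Matrix01 m n = Fin m → Fin n → Bool

J₂-free : ∀ {m n} → Matrix01 m n → Set
J₂-free {m} {n} A = (p q : Fin m) (L M : Fin n) → p ≢ q → L ≢ M →
  ¬ (A p L ≡ true × A p M ≡ true × A q L ≡ true × A q M ≡ true)

IsConfiguration : ∀ {m n} → ℕ → ℕ → Matrix01 m n → Set
IsConfiguration k l A =
  J₂-free A ×
  (∀ p → sumFin (λ L → b2n (A p L)) ≡ k) ×
  (∀ L → sumFin (λ p → b2n (A p L)) ≡ l)

iter : ∀ {A : Set} → (A → A) → ℕ → A → A
iter f ℕ.zero    x = x
iter f (ℕ.suc i) x = f (iter f i x)

IsAutomorphism : ∀ {m n} → Matrix01 m n → Permutation′ m → Permutation′ n → Set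
IsAutomorphism A π τ = ∀ p L → A (π ⟨$⟩ʳ p) (τ ⟨$⟩ʳ L) ≡ A p L

HasOrder : ∀ {m n} → Permutation′ m → Permutation′ n → ℕ → Set
HasOrder {m} {n} π τ μ =
  0 < μ ×
  (∀ p → iter (π ⟨$⟩ʳ_) μ p ≡ p) × (∀ L → iter (τ ⟨$⟩ʳ_) μ L ≡ L) ×
  (∀ i → 0 < i → i < μ →
     ¬ ((∀ p → iter (π ⟨$⟩ʳ_) i p ≡ p) × (∀ L → iter (τ ⟨$⟩ʳ_) i L ≡ L)))

OrbitSize : ∀ {A : Set} → (A → A) → A → ℕ → Set
OrbitSize f x μ =
  iter f μ x ≡ x × (∀ i j → i < μ → j < μ → iter f i x ≡ iter f j x → i ≡ j)

Polycyclic : ∀ {m n} → Matrix01 m n → ℕ → Set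
Polycyclic {m} {n} A μ =
  Σ (Permutation′ m) λ π → Σ (Permutation′ n) λ τ →
    IsAutomorphism A π τ × HasOrder π τ μ ×
    (∀ p → OrbitSize (π ⟨$⟩ʳ_) p μ) × (∀ L → OrbitSize (τ ⟨$⟩ʳ_) L μ)

Scheme : ℕ → ℕ → ℕ → Set
Scheme μ ρ σ = Fin ρ → Fin σ → Subset μ

HasValency : ∀ {μ ρ σ} → Scheme μ ρ σ → ℕ → ℕ → Set
HasValency S k l =
  (∀ i → sumFin (λ j → ∣ S i j ∣) ≡ k) × (∀ j → sumFin (λ i → ∣ S i j ∣) ≡ l)

-- (b - a) mod μ as an element of Z_μ = Fin μ
subMod : ∀ {μ} → Fin μ → Fin μ → Fin μ
subMod {ℕ.suc n} b a = fromℕ< (m%n<n ((ℕ.suc n + toℕ b) ∸ toℕ a) (ℕ.suc n))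

circulant : ∀ {μ} → Subset μ → Matrix01 μ μ
circulant C a b = lookup C (subMod b a)

-- blow-up: row index i*μ + a (block i, offset a), column index j*μ + b
blowUp : ∀ {μ ρ σ} → Scheme μ ρ σ → Matrix01 (ρ * μ) (σ * μ)
blowUp {μ} {ρ} {σ} S r c =
  circulant (S (proj₁ (remQuot {ρ} μ r)) (proj₁ (remQuot {σ} μ c)))
            (proj₂ (remQuot {ρ} μ r)) (proj₂ (remQuot {σ} μ c))

-- Forward: orbit coordinates for the automorphism (π , τ) exhibit C as the
-- blow-up of the scheme of incidences between orbits.  Backward: rotating
-- the offsets of the blow-up, transported to C, is an automorphism whose
-- orbits are the blocks, of size μ.
module Submission where

open import Defs
open import Data.Nat using (ℕ; zero; suc; _+_; _*_; _∸_; _<_; _≤_; _≤?_; z≤n; s≤s; NonZero)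
open import Data.Nat.Properties
open import Data.Nat.DivMod using (_%_; _/_; m≡m%n+[m/n]*n; m%n<n; m%n%n≡m%n; %-distribˡ-+; [m+n]%n≡m%n; [m+kn]%n≡m%n; m<n⇒m%n≡m)
open import Data.Bool using (true; false)
open import Data.Fin using (Fin; zero; suc; toℕ; fromℕ<; remQuot; combine; _↑ˡ_; _↑ʳ_)
open import Data.Fin.Properties using (toℕ-fromℕ<; toℕ<n; toℕ-injective; remQuot-combine; combine-remQuot; all?)
open import Data.Fin.Permutation using (Permutation; Permutation′; _⟨$⟩ʳ_; _⟨$⟩ˡ_; permutation; inverseˡ; inverseʳ; flip; _∘ₚ_; ↔⇒≡)
open import Data.Fin.Subset using (Subset; ∣_∣)
open import Data.Vec using ([]; _∷_; lookup; tabulate)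
open import Data.Vec.Properties using (lookup∘tabulate)
open import Data.List using (List; length; filter; allFin)
import Data.List as List
open import Data.List.Relation.Unary.Any using (index)
open import Data.List.Relation.Unary.Any.Properties using (lookup-index)
open import Data.List.Relation.Unary.All as All using ()
open import Data.List.Relation.Unary.AllPairs using (_∷_)
open import Data.List.Relation.Unary.Unique.Propositional using (Unique)
open import Data.List.Relation.Unary.Unique.Propositional.Properties using (filter⁺; allFin⁺)
open import Data.List.Membership.Propositional using (_∈_)
open import Data.List.Membership.Propositional.Properties using (∈-filter⁺; ∈-filter⁻; ∈-allFin; ∈-lookup)
open import Data.Product using (_×_; Σ; _,_; proj₁; proj₂; uncurry)
open import Data.Empty using (⊥-elim)
open import Function.Bundles using (_⇔_; mk⇔)
open import Relation.Binary.PropositionalEquality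
open import Relation.Nullary using (Dec; yes; no)
import Algebra.Properties.CommutativeMonoid.Sum as MonoidSum

open ≡-Reasoning

%-absorbˡ : ∀ x y n .{{_ : NonZero n}} → (x % n + y) % n ≡ (x + y) % n
%-absorbˡ x y n = begin
  (x % n + y) % n          ≡⟨ %-distribˡ-+ (x % n) y n ⟩
  (x % n % n + y % n) % n  ≡⟨ cong (λ z → (z + y % n) % n) (m%n%n≡m%n x n) ⟩
  (x % n + y % n) % n      ≡⟨ %-distribˡ-+ x y n ⟨
  (x + y) % n              ∎

%-absorbʳ : ∀ x y n .{{_ : NonZero n}} → (x + y % n) % n ≡ (x + y) % n
%-absorbʳ x y n = begin
  (x + y % n) % n  ≡⟨ cong (_% n) (+-comm x (y % n)) ⟩
  (y % n + x) % n  ≡⟨ %-absorbˡ y x n ⟩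
  (y + x) % n      ≡⟨ cong (_% n) (+-comm y x) ⟩
  (x + y) % n      ∎

-- Adding a * m undoes the translation by a modulo suc m, so a residue
-- x < suc m can be recovered from (a + x) mod suc m.
%-untranslate : ∀ a x m → x < suc m → ((a + x) % suc m + a * m) % suc m ≡ x
%-untranslate a x m x<n = begin
  ((a + x) % suc m + a * m) % suc m  ≡⟨ %-absorbˡ (a + x) (a * m) (suc m) ⟩
  (a + x + a * m) % suc m            ≡⟨ cong (_% suc m) rearrange ⟩
  (x + a * suc m) % suc m            ≡⟨ [m+kn]%n≡m%n x a (suc m) ⟩
  x % suc m                          ≡⟨ m<n⇒m%n≡m x<n ⟩
  x                                  ∎
  where
  rearrange : a + x + a * m ≡ x + a * suc m
  rearrange = begin
    a + x + a * m    ≡⟨ cong (_+ a * m) (+-comm a x) ⟩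
    x + a + a * m    ≡⟨ +-assoc x a (a * m) ⟩
    x + (a + a * m)  ≡⟨ cong (x +_) (*-suc a m) ⟨
    x + a * suc m    ∎

%-translate-injective : ∀ a {x y} m → x < suc m → y < suc m →
  (a + x) % suc m ≡ (a + y) % suc m → x ≡ y
%-translate-injective a {x} {y} m x<n y<n eq = begin
  x                                  ≡⟨ %-untranslate a x m x<n ⟨
  ((a + x) % suc m + a * m) % suc m  ≡⟨ cong (λ z → (z + a * m) % suc m) eq ⟩
  ((a + y) % suc m + a * m) % suc m  ≡⟨ %-untranslate a y m y<n ⟩
  y                                  ∎

-- Arithmetic in Z_n, with n = suc m and Z_n = Fin n

infixl 6 _⊕_
_⊕_ : ∀ {m} → Fin (suc m) → ℕ → Fin (suc m)
_⊕_ {m} a t = fromℕ< (m%n<n (toℕ a + t) (suc m))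

toℕ-⊕ : ∀ {m} (a : Fin (suc m)) t → toℕ (a ⊕ t) ≡ (toℕ a + t) % suc m
toℕ-⊕ {m} a t = toℕ-fromℕ< (m%n<n (toℕ a + t) (suc m))

⊕-identityʳ : ∀ {m} (a : Fin (suc m)) → a ⊕ 0 ≡ a
⊕-identityʳ {m} a = toℕ-injective (begin
  toℕ (a ⊕ 0)          ≡⟨ toℕ-⊕ a 0 ⟩
  (toℕ a + 0) % suc m  ≡⟨ cong (_% suc m) (+-identityʳ (toℕ a)) ⟩
  toℕ a % suc m        ≡⟨ m<n⇒m%n≡m (toℕ<n a) ⟩
  toℕ a                ∎)

⊕-period : ∀ {m} (a : Fin (suc m)) → a ⊕ suc m ≡ a
⊕-period {m} a = toℕ-injective (begin
  toℕ (a ⊕ suc m)          ≡⟨ toℕ-⊕ a (suc m) ⟩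
  (toℕ a + suc m) % suc m  ≡⟨ [m+n]%n≡m%n (toℕ a) (suc m) ⟩
  toℕ a % suc m            ≡⟨ m<n⇒m%n≡m (toℕ<n a) ⟩
  toℕ a                    ∎)

⊕-assoc : ∀ {m} (a : Fin (suc m)) s t → a ⊕ s ⊕ t ≡ a ⊕ (s + t)
⊕-assoc {m} a s t = toℕ-injective (begin
  toℕ (a ⊕ s ⊕ t)                      ≡⟨ toℕ-⊕ (a ⊕ s) t ⟩
  (toℕ (a ⊕ s) + t) % suc m            ≡⟨ cong (λ z → (z + t) % suc m) (toℕ-⊕ a s) ⟩
  ((toℕ a + s) % suc m + t) % suc m    ≡⟨ %-absorbˡ (toℕ a + s) t (suc m) ⟩
  (toℕ a + s + t) % suc m              ≡⟨ cong (_% suc m) (+-assoc (toℕ a) s t) ⟩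
  (toℕ a + (s + t)) % suc m            ≡⟨ toℕ-⊕ a (s + t) ⟨
  toℕ (a ⊕ (s + t))                    ∎)

⊕-comm : ∀ {m} (a b : Fin (suc m)) → a ⊕ toℕ b ≡ b ⊕ toℕ a
⊕-comm {m} a b = toℕ-injective (begin
  toℕ (a ⊕ toℕ b)            ≡⟨ toℕ-⊕ a (toℕ b) ⟩
  (toℕ a + toℕ b) % suc m    ≡⟨ cong (_% suc m) (+-comm (toℕ a) (toℕ b)) ⟩
  (toℕ b + toℕ a) % suc m    ≡⟨ toℕ-⊕ b (toℕ a) ⟨
  toℕ (b ⊕ toℕ a)            ∎)

⊕-cancelˡ : ∀ {m} (a : Fin (suc m)) {s t} → s < suc m → t < suc m → a ⊕ s ≡ a ⊕ t → s ≡ t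
⊕-cancelˡ {m} a {s} {t} s<n t<n eq = %-translate-injective (toℕ a) m s<n t<n (begin
  (toℕ a + s) % suc m  ≡⟨ toℕ-⊕ a s ⟨
  toℕ (a ⊕ s)          ≡⟨ cong toℕ eq ⟩
  toℕ (a ⊕ t)          ≡⟨ toℕ-⊕ a t ⟩
  (toℕ a + t) % suc m  ∎)

⊕-subMod : ∀ {m} (b a : Fin (suc m)) → a ⊕ toℕ (subMod b a) ≡ b
⊕-subMod {m} b a = toℕ-injective (begin
  toℕ (a ⊕ toℕ (subMod b a))                     ≡⟨ toℕ-⊕ a (toℕ (subMod b a)) ⟩
  (toℕ a + toℕ (subMod b a)) % n                 ≡⟨ cong (λ z → (toℕ a + z) % n) toℕ-subMod ⟩
  (toℕ a + (n + toℕ b ∸ toℕ a) % n) % n          ≡⟨ %-absorbʳ (toℕ a) (n + toℕ b ∸ toℕ a) n ⟩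
  (toℕ a + (n + toℕ b ∸ toℕ a)) % n              ≡⟨ cong (_% n) (m+[n∸m]≡n a≤n+b) ⟩
  (n + toℕ b) % n                                ≡⟨ cong (_% n) (+-comm n (toℕ b)) ⟩
  (toℕ b + n) % n                                ≡⟨ [m+n]%n≡m%n (toℕ b) n ⟩
  toℕ b % n                                      ≡⟨ m<n⇒m%n≡m (toℕ<n b) ⟩
  toℕ b                                          ∎)
  where
  n : ℕ
  n = suc m
  toℕ-subMod : toℕ (subMod b a) ≡ (n + toℕ b ∸ toℕ a) % n
  toℕ-subMod = toℕ-fromℕ< (m%n<n (n + toℕ b ∸ toℕ a) n)
  a≤n+b : toℕ a ≤ n + toℕ b
  a≤n+b = ≤-trans (<⇒≤ (toℕ<n a)) (m≤m+n n (toℕ b))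

subMod-unique : ∀ {m} (a : Fin (suc m)) {b c} → a ⊕ toℕ c ≡ b → subMod b a ≡ c
subMod-unique a {b} {c} eq =
  toℕ-injective (⊕-cancelˡ a (toℕ<n (subMod b a)) (toℕ<n c) (trans (⊕-subMod b a) (sym eq)))

subMod-⊕ : ∀ {m} t (b a : Fin (suc m)) → subMod (b ⊕ t) (a ⊕ t) ≡ subMod b a
subMod-⊕ t b a = subMod-unique (a ⊕ t) (begin
  a ⊕ t ⊕ s    ≡⟨ ⊕-assoc a t s ⟩
  a ⊕ (t + s)  ≡⟨ cong (a ⊕_) (+-comm t s) ⟩
  a ⊕ (s + t)  ≡⟨ ⊕-assoc a s t ⟨
  a ⊕ s ⊕ t    ≡⟨ cong (_⊕ t) (⊕-subMod b a) ⟩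
  b ⊕ t        ∎)
  where
  s : ℕ
  s = toℕ (subMod b a)

translation : ∀ {m} → Fin (suc m) → Permutation′ (suc m)
translation a = permutation (λ b → subMod b a) (λ c → a ⊕ toℕ c)
  (λ c → subMod-unique a refl) (λ b → ⊕-subMod b a)

reflection : ∀ {m} → Fin (suc m) → Permutation′ (suc m)
reflection b = permutation (subMod b) (subMod b) involutive involutive
  where
  involutive : ∀ a → subMod b (subMod b a) ≡ a
  involutive a = subMod-unique (subMod b a) (trans (⊕-comm (subMod b a) a) (⊕-subMod b a))

iter-+ : ∀ {A : Set} (f : A → A) s t x → iter f (s + t) x ≡ iter f s (iter f t x)
iter-+ f zero    t x = refl
iter-+ f (suc s) t x = cong f (iter-+ f s t x)

-- For f of period n = suc m, iterates only depend on the exponent modulo n,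
-- so the orbit of x can be indexed by Z_n.
module Periodic {A : Set} (f : A → A) (m : ℕ) (period : ∀ x → iter f (suc m) x ≡ x) where

  iter-multiple : ∀ k x → iter f (k * suc m) x ≡ x
  iter-multiple zero    x = refl
  iter-multiple (suc k) x = begin
    iter f (suc m + k * suc m) x          ≡⟨ iter-+ f (suc m) (k * suc m) x ⟩
    iter f (suc m) (iter f (k * suc m) x) ≡⟨ period _ ⟩
    iter f (k * suc m) x                  ≡⟨ iter-multiple k x ⟩
    x                                     ∎

  iter-% : ∀ t x → iter f (t % suc m) x ≡ iter f t x
  iter-% t x = begin
    iter f (t % suc m) x                             ≡⟨ cong (iter f (t % suc m)) (iter-multiple (t / suc m) x) ⟨
    iter f (t % suc m) (iter f (t / suc m * suc m) x) ≡⟨ iter-+ f (t % suc m) (t / suc m * suc m) x ⟨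
    iter f (t % suc m + t / suc m * suc m) x          ≡⟨ cong (λ z → iter f z x) (m≡m%n+[m/n]*n t (suc m)) ⟨
    iter f t x                                        ∎

  orbit : A → Fin (suc m) → A
  orbit x a = iter f (toℕ a) x

  orbit-orbit : ∀ x a b → orbit (orbit x a) b ≡ orbit x (b ⊕ toℕ a)
  orbit-orbit x a b = begin
    iter f (toℕ b) (iter f (toℕ a) x)      ≡⟨ iter-+ f (toℕ b) (toℕ a) x ⟨
    iter f (toℕ b + toℕ a) x               ≡⟨ iter-% (toℕ b + toℕ a) x ⟨
    iter f ((toℕ b + toℕ a) % suc m) x     ≡⟨ cong (λ z → iter f z x) (toℕ-⊕ b (toℕ a)) ⟨
    iter f (toℕ (b ⊕ toℕ a)) x             ∎

  orbit-return : ∀ x a → orbit (orbit x a) (subMod zero a) ≡ x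
  orbit-return x a = begin
    orbit (orbit x a) (subMod zero a)   ≡⟨ orbit-orbit x a (subMod zero a) ⟩
    orbit x (subMod zero a ⊕ toℕ a)     ≡⟨ cong (orbit x) (⊕-comm (subMod zero a) a) ⟩
    orbit x (a ⊕ toℕ (subMod zero a))   ≡⟨ cong (orbit x) (⊕-subMod zero a) ⟩
    x                                   ∎

sumFin-cong : ∀ {n} {f g : Fin n → ℕ} → (∀ i → f i ≡ g i) → sumFin f ≡ sumFin g
sumFin-cong {zero}  eq = refl
sumFin-cong {suc n} eq = cong₂ _+_ (eq zero) (sumFin-cong (λ i → eq (suc i)))

open MonoidSum +-0-commutativeMonoid using (sum; sum-permute)

-- sumFin agrees with the library's sum, whose permutation invariance we use.
sumFin≡sum : ∀ {n} (f : Fin n → ℕ) → sumFin f ≡ sum f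
sumFin≡sum {zero}  f = refl
sumFin≡sum {suc n} f = cong (f zero +_) (sumFin≡sum (λ i → f (suc i)))

sumFin-permute : ∀ {n} (π : Permutation′ n) (f : Fin n → ℕ) → sumFin (λ i → f (π ⟨$⟩ʳ i)) ≡ sumFin f
sumFin-permute π f = begin
  sumFin (λ i → f (π ⟨$⟩ʳ i))  ≡⟨ sumFin≡sum (λ i → f (π ⟨$⟩ʳ i)) ⟩
  sum (λ i → f (π ⟨$⟩ʳ i))     ≡⟨ sum-permute f π ⟨
  sum f                        ≡⟨ sumFin≡sum f ⟨
  sumFin f                     ∎

sumFin-++ : ∀ a b (f : Fin (a + b) → ℕ) →
  sumFin f ≡ sumFin (λ i → f (i ↑ˡ b)) + sumFin (λ i → f (a ↑ʳ i))
sumFin-++ zero    b f = refl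
sumFin-++ (suc a) b f = trans (cong (f zero +_) (sumFin-++ a b (λ i → f (suc i))))
                              (sym (+-assoc (f zero) _ _))

sumFin-combine : ∀ a b (f : Fin (a * b) → ℕ) →
  sumFin f ≡ sumFin {a} (λ i → sumFin {b} (λ c → f (combine i c)))
sumFin-combine zero    b f = refl
sumFin-combine (suc a) b f = trans (sumFin-++ b (a * b) f)
  (cong (sumFin (λ c → f (c ↑ˡ (a * b))) +_) (sumFin-combine a b (λ i → f (b ↑ʳ i))))

∣∣≡sumFin : ∀ {n} (X : Subset n) → ∣ X ∣ ≡ sumFin (λ c → b2n (lookup X c))
∣∣≡sumFin []          = refl
∣∣≡sumFin (true  ∷ X) = cong suc (∣∣≡sumFin X)
∣∣≡sumFin (false ∷ X) = ∣∣≡sumFin X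

-- Blocks, offsets and blow-ups

by-blocks : ∀ R n {P : Fin (R * n) → Set} → (∀ i a → P (combine i a)) → ∀ x → P x
by-blocks R n {P} h x = subst P (combine-remQuot {R} n x) (h (proj₁ (remQuot {R} n x)) (proj₂ (remQuot {R} n x)))

blowUp-combine : ∀ {μ ρ σ} (S : Scheme μ ρ σ) i a j b →
  blowUp S (combine i a) (combine j b) ≡ lookup (S i j) (subMod b a)
blowUp-combine {μ} {ρ} {σ} S i a j b =
  cong₂ (λ u v → circulant (S (proj₁ u) (proj₁ v)) (proj₂ u) (proj₂ v))
        (remQuot-combine {ρ} {μ} i a) (remQuot-combine {σ} {μ} j b)

module Blocks (R m : ℕ) where

  block : Fin (R * suc m) → Fin R
  block x = proj₁ (remQuot {R} (suc m) x)

  offset : Fin (R * suc m) → Fin (suc m)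
  offset x = proj₂ (remQuot {R} (suc m) x)

  blockRotate : ℕ → Fin (R * suc m) → Fin (R * suc m)
  blockRotate t x = combine (block x) (offset x ⊕ t)

  blockRotate-combine : ∀ t i a → blockRotate t (combine i a) ≡ combine i (a ⊕ t)
  blockRotate-combine t i a = cong (λ u → combine (proj₁ u) (proj₂ u ⊕ t)) (remQuot-combine {R} {suc m} i a)

  offset-blockRotate : ∀ t x → offset (blockRotate t x) ≡ offset x ⊕ t
  offset-blockRotate t x = cong proj₂ (remQuot-combine {R} {suc m} (block x) (offset x ⊕ t))

  blockRotate-blockRotate : ∀ s t x → blockRotate t (blockRotate s x) ≡ blockRotate (s + t) x
  blockRotate-blockRotate s t x = begin
    blockRotate t (combine (block x) (offset x ⊕ s))  ≡⟨ blockRotate-combine t (block x) (offset x ⊕ s) ⟩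
    combine (block x) (offset x ⊕ s ⊕ t)              ≡⟨ cong (combine (block x)) (⊕-assoc (offset x) s t) ⟩
    combine (block x) (offset x ⊕ (s + t))            ∎

  blockRotate-zero : ∀ x → blockRotate 0 x ≡ x
  blockRotate-zero x = trans (cong (combine (block x)) (⊕-identityʳ (offset x))) (combine-remQuot {R} (suc m) x)

  blockRotate-period : ∀ x → blockRotate (suc m) x ≡ x
  blockRotate-period x = trans (cong (combine (block x)) (⊕-period (offset x))) (combine-remQuot {R} (suc m) x)

  iter-blockRotate : ∀ i x → iter (blockRotate 1) i x ≡ blockRotate i x
  iter-blockRotate zero    x = sym (blockRotate-zero x)
  iter-blockRotate (suc i) x = begin
    blockRotate 1 (iter (blockRotate 1) i x)  ≡⟨ cong (blockRotate 1) (iter-blockRotate i x) ⟩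
    blockRotate 1 (blockRotate i x)           ≡⟨ blockRotate-blockRotate i 1 x ⟩
    blockRotate (i + 1) x                     ≡⟨ cong (λ t → blockRotate t x) (+-comm i 1) ⟩
    blockRotate (suc i) x                     ∎

  blockRotation : Permutation′ (R * suc m)
  blockRotation = permutation (blockRotate 1) (blockRotate m)
    (λ y → begin
      blockRotate 1 (blockRotate m y)  ≡⟨ blockRotate-blockRotate m 1 y ⟩
      blockRotate (m + 1) y            ≡⟨ cong (λ t → blockRotate t y) (+-comm m 1) ⟩
      blockRotate (suc m) y            ≡⟨ blockRotate-period y ⟩
      y                                ∎)
    (λ x → trans (blockRotate-blockRotate 1 m x) (blockRotate-period x))

  blockRotation-orbitSize : ∀ x → OrbitSize (blockRotation ⟨$⟩ʳ_) x (suc m)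
  blockRotation-orbitSize x = trans (iter-blockRotate (suc m) x) (blockRotate-period x) , distinct
    where
    distinct : ∀ i j → i < suc m → j < suc m → iter (blockRotate 1) i x ≡ iter (blockRotate 1) j x → i ≡ j
    distinct i j i<n j<n eq = ⊕-cancelˡ (offset x) i<n j<n (begin
      offset x ⊕ i                       ≡⟨ offset-blockRotate i x ⟨
      offset (blockRotate i x)           ≡⟨ cong offset (iter-blockRotate i x) ⟨
      offset (iter (blockRotate 1) i x)  ≡⟨ cong offset eq ⟩
      offset (iter (blockRotate 1) j x)  ≡⟨ cong offset (iter-blockRotate j x) ⟩
      offset (blockRotate j x)           ≡⟨ offset-blockRotate j x ⟩
      offset x ⊕ j                       ∎)

blowUp-blockRotate : ∀ {m ρ σ} (S : Scheme (suc m) ρ σ) t p L →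
  blowUp S (Blocks.blockRotate ρ m t p) (Blocks.blockRotate σ m t L) ≡ blowUp S p L
blowUp-blockRotate {m} {ρ} {σ} S t p L =
  trans (blowUp-combine S (P.block p) (P.offset p ⊕ t) (L.block L) (L.offset L ⊕ t))
        (cong (lookup (S (P.block p) (L.block L))) (subMod-⊕ t (L.offset L) (P.offset p)))
  where
  module P = Blocks ρ m
  module L = Blocks σ m

blowUp-rowSum : ∀ {m ρ σ} (S : Scheme (suc m) ρ σ) i a →
  sumFin (λ L → b2n (blowUp S (combine i a) L)) ≡ sumFin (λ j → ∣ S i j ∣)
blowUp-rowSum {m} {ρ} {σ} S i a = begin
  sumFin {σ * suc m} (λ L → b2n (blowUp S (combine i a) L))
    ≡⟨ sumFin-combine σ (suc m) _ ⟩
  sumFin {σ} (λ j → sumFin (λ b → b2n (blowUp S (combine i a) (combine j b))))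
    ≡⟨ sumFin-cong (λ j → sumFin-cong (λ b → cong b2n (blowUp-combine S i a j b))) ⟩
  sumFin (λ j → sumFin (λ b → b2n (lookup (S i j) (subMod b a))))
    ≡⟨ sumFin-cong (λ j → sumFin-permute (translation a) (λ c → b2n (lookup (S i j) c))) ⟩
  sumFin (λ j → sumFin (λ c → b2n (lookup (S i j) c)))
    ≡⟨ sumFin-cong (λ j → ∣∣≡sumFin (S i j)) ⟨
  sumFin (λ j → ∣ S i j ∣) ∎

blowUp-columnSum : ∀ {m ρ σ} (S : Scheme (suc m) ρ σ) j b →
  sumFin (λ p → b2n (blowUp S p (combine j b))) ≡ sumFin (λ i → ∣ S i j ∣)
blowUp-columnSum {m} {ρ} {σ} S j b = begin
  sumFin {ρ * suc m} (λ p → b2n (blowUp S p (combine j b)))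
    ≡⟨ sumFin-combine ρ (suc m) _ ⟩
  sumFin {ρ} (λ i → sumFin (λ a → b2n (blowUp S (combine i a) (combine j b))))
    ≡⟨ sumFin-cong (λ i → sumFin-cong (λ a → cong b2n (blowUp-combine S i a j b))) ⟩
  sumFin (λ i → sumFin (λ a → b2n (lookup (S i j) (subMod b a))))
    ≡⟨ sumFin-cong (λ i → sumFin-permute (reflection b) (λ c → b2n (lookup (S i j) c))) ⟩
  sumFin (λ i → sumFin (λ c → b2n (lookup (S i j) c)))
    ≡⟨ sumFin-cong (λ i → ∣∣≡sumFin (S i j)) ⟨
  sumFin (λ i → ∣ S i j ∣) ∎

valency-from-blowUp : ∀ {m ρ σ k l} (C : Matrix01 (ρ * suc m) (σ * suc m))
  (α : Permutation′ (ρ * suc m)) (β : Permutation′ (σ * suc m)) (S : Scheme (suc m) ρ σ) →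
  (∀ p L → C (α ⟨$⟩ʳ p) (β ⟨$⟩ʳ L) ≡ blowUp S p L) →
  (∀ p → sumFin (λ L → b2n (C p L)) ≡ k) → (∀ L → sumFin (λ p → b2n (C p L)) ≡ l) →
  HasValency S k l
valency-from-blowUp {m} {ρ} {σ} {k} {l} C α β S relabel rows columns = rowValency , columnValency
  where
  rowValency : ∀ i → sumFin (λ j → ∣ S i j ∣) ≡ k
  rowValency i = begin
    sumFin (λ j → ∣ S i j ∣)                        ≡⟨ blowUp-rowSum S i zero ⟨
    sumFin (λ L → b2n (blowUp S p L))               ≡⟨ sumFin-cong (λ L → cong b2n (relabel p L)) ⟨
    sumFin (λ L → b2n (C (α ⟨$⟩ʳ p) (β ⟨$⟩ʳ L)))     ≡⟨ sumFin-permute β (λ L → b2n (C (α ⟨$⟩ʳ p) L)) ⟩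
    sumFin (λ L → b2n (C (α ⟨$⟩ʳ p) L))             ≡⟨ rows (α ⟨$⟩ʳ p) ⟩
    k                                               ∎
    where
    p : Fin (ρ * suc m)
    p = combine i zero
  columnValency : ∀ j → sumFin (λ i → ∣ S i j ∣) ≡ l
  columnValency j = begin
    sumFin (λ i → ∣ S i j ∣)                        ≡⟨ blowUp-columnSum S j zero ⟨
    sumFin (λ p → b2n (blowUp S p L))               ≡⟨ sumFin-cong (λ p → cong b2n (relabel p L)) ⟨
    sumFin (λ p → b2n (C (α ⟨$⟩ʳ p) (β ⟨$⟩ʳ L)))     ≡⟨ sumFin-permute α (λ p → b2n (C p (β ⟨$⟩ʳ L))) ⟩
    sumFin (λ p → b2n (C p (β ⟨$⟩ʳ L)))             ≡⟨ columns (β ⟨$⟩ʳ L) ⟩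
    l                                               ∎
    where
    L : Fin (σ * suc m)
    L = combine j zero

-- α σ α⁻¹, i.e. σ transported along the relabelling α
conjugate : ∀ {N} → Permutation′ N → Permutation′ N → Permutation′ N
conjugate α σ = flip α ∘ₚ σ ∘ₚ α

iter-conjugate : ∀ {N} (α σ : Permutation′ N) i p →
  iter (conjugate α σ ⟨$⟩ʳ_) i p ≡ α ⟨$⟩ʳ iter (σ ⟨$⟩ʳ_) i (α ⟨$⟩ˡ p)
iter-conjugate α σ zero    p = sym (inverseʳ α)
iter-conjugate α σ (suc i) p =
  cong (λ y → α ⟨$⟩ʳ (σ ⟨$⟩ʳ y)) (trans (cong (α ⟨$⟩ˡ_) (iter-conjugate α σ i p)) (inverseˡ α))

orbitSize-conjugate : ∀ {N n} (α σ : Permutation′ N) →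
  (∀ x → OrbitSize (σ ⟨$⟩ʳ_) x n) → ∀ p → OrbitSize (conjugate α σ ⟨$⟩ʳ_) p n
orbitSize-conjugate {N} {n} α σ orbitSize p = period , distinct
  where
  x : Fin N
  x = α ⟨$⟩ˡ p
  period : iter (conjugate α σ ⟨$⟩ʳ_) n p ≡ p
  period = trans (iter-conjugate α σ n p) (trans (cong (α ⟨$⟩ʳ_) (proj₁ (orbitSize x))) (inverseʳ α))
  α-injective : ∀ {y z} → α ⟨$⟩ʳ y ≡ α ⟨$⟩ʳ z → y ≡ z
  α-injective {y} {z} eq = trans (sym (inverseˡ α)) (trans (cong (α ⟨$⟩ˡ_) eq) (inverseˡ α))
  distinct : ∀ i j → i < n → j < n → iter (conjugate α σ ⟨$⟩ʳ_) i p ≡ iter (conjugate α σ ⟨$⟩ʳ_) j p → i ≡ j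
  distinct i j i<n j<n eq = proj₂ (orbitSize x) i j i<n j<n
    (α-injective (trans (sym (iter-conjugate α σ i p)) (trans eq (iter-conjugate α σ j p))))

-- If all orbits of π and τ have μ elements and there is at least one point,
-- then (π , τ) has order μ: a smaller power would fix that point.
orbitSizes⇒order : ∀ {M N μ} (π : Permutation′ M) (τ : Permutation′ N) → 0 < μ → Fin M →
  (∀ p → OrbitSize (π ⟨$⟩ʳ_) p μ) → (∀ L → OrbitSize (τ ⟨$⟩ʳ_) L μ) → HasOrder π τ μ
orbitSizes⇒order π τ 0<μ p orbitsπ orbitsτ =
  0<μ , (λ q → proj₁ (orbitsπ q)) , (λ L → proj₁ (orbitsτ L)) ,
  λ i 0<i i<μ fixed → <⇒≢ 0<i (sym (proj₂ (orbitsπ p) i 0 i<μ 0<μ (proj₁ fixed p)))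

-- Orbit coordinates

minimiser : ∀ {n} (g : Fin (suc n) → ℕ) → Σ (Fin (suc n)) λ a → ∀ b → g a ≤ g b
minimiser {zero}  g = zero , λ { zero → ≤-refl }
minimiser {suc n} g with minimiser (λ i → g (suc i))
... | a , least with g zero ≤? g (suc a)
...   | yes g₀≤ = zero , λ { zero → ≤-refl ; (suc b) → ≤-trans g₀≤ (least b) }
...   | no  g₀≰ = suc a , λ { zero → <⇒≤ (≰⇒> g₀≰) ; (suc b) → least b }

unique⇒lookup-injective : ∀ {A : Set} {xs : List A} → Unique xs →
  ∀ i j → List.lookup xs i ≡ List.lookup xs j → i ≡ j
unique⇒lookup-injective (x∉ ∷ _) zero    zero    _  = refl
unique⇒lookup-injective (x∉ ∷ _) zero    (suc j) eq = ⊥-elim (All.lookup x∉ (∈-lookup j) eq)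
unique⇒lookup-injective (x∉ ∷ _) (suc i) zero    eq = ⊥-elim (All.lookup x∉ (∈-lookup i) (sym eq))
unique⇒lookup-injective (_  ∷ u) (suc i) (suc j) eq = cong suc (unique⇒lookup-injective u i j eq)

BlockCoordinates : (R n : ℕ) {N : ℕ} → (Fin N → Fin N) → Set
BlockCoordinates R n {N} f = Σ (Permutation (R * n) N) λ α → Σ (Fin R → Fin N) λ rep →
  ∀ i a → α ⟨$⟩ʳ combine i a ≡ iter f (toℕ a) (rep i)

blockCoordinates : ∀ {R n N} (f : Fin N → Fin N) (rep : Fin R → Fin N) (coord : Fin N → Fin R × Fin n) →
  (∀ p → iter f (toℕ (proj₂ (coord p))) (rep (proj₁ (coord p))) ≡ p) →
  (∀ i a → coord (iter f (toℕ a) (rep i)) ≡ (i , a)) → BlockCoordinates R n f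
blockCoordinates {R} {n} {N} f rep coord sound complete =
  α , rep , λ i a → cong place (remQuot-combine {R} {n} i a)
  where
  place : Fin R × Fin n → Fin N
  place u = iter f (toℕ (proj₂ u)) (rep (proj₁ u))
  α : Permutation (R * n) N
  α = permutation (λ x → place (remQuot {R} n x)) (λ p → uncurry combine (coord p))
    (λ p → trans (cong place (remQuot-combine {R} {n} _ _)) (sound p))
    (λ x → trans (cong (uncurry combine) (complete _ _)) (combine-remQuot {R} n x))

blockCount : ∀ {R ρ m} {f : Fin (ρ * suc m) → Fin (ρ * suc m)} → BlockCoordinates R (suc m) f → R ≡ ρ
blockCount {R} {ρ} {m} (α , _) = *-cancelʳ-≡ R ρ (suc m) (↔⇒≡ α)

-- If every orbit of f has n = suc m elements, taking the least element of
-- each orbit as its representative yields a block coordinate system.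
module OrbitDecomposition {N m : ℕ} (f : Fin N → Fin N) (orbitSize : ∀ p → OrbitSize f p (suc m)) where
  open Periodic f m (λ p → proj₁ (orbitSize p))

  orbit-injective : ∀ p {a b} → orbit p a ≡ orbit p b → a ≡ b
  orbit-injective p {a} {b} eq = toℕ-injective (proj₂ (orbitSize p) (toℕ a) (toℕ b) (toℕ<n a) (toℕ<n b) eq)

  IsRepresentative : Fin N → Set
  IsRepresentative p = ∀ a → toℕ p ≤ toℕ (orbit p a)

  isRepresentative? : ∀ p → Dec (IsRepresentative p)
  isRepresentative? p = all? (λ a → toℕ p ≤? toℕ (orbit p a))

  leastPosition : Fin N → Fin (suc m)
  leastPosition p = proj₁ (minimiser (λ a → toℕ (orbit p a)))

  representative : Fin N → Fin N
  representative p = orbit p (leastPosition p)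

  representative-isRepresentative : ∀ p → IsRepresentative (representative p)
  representative-isRepresentative p a =
    subst (λ q → toℕ (representative p) ≤ toℕ q) (sym (orbit-orbit p (leastPosition p) a))
          (proj₂ (minimiser (λ b → toℕ (orbit p b))) (a ⊕ toℕ (leastPosition p)))

  representative-unique : ∀ {p q} → IsRepresentative p → IsRepresentative q → ∀ a → q ≡ orbit p a → q ≡ p
  representative-unique {p} {q} isRepP isRepQ a q≡ = toℕ-injective (≤-antisym q≤p p≤q)
    where
    p≤q : toℕ p ≤ toℕ q
    p≤q = subst (λ z → toℕ p ≤ toℕ z) (sym q≡) (isRepP a)
    p≡ : orbit q (subMod zero a) ≡ p
    p≡ = trans (cong (λ z → orbit z (subMod zero a)) q≡) (orbit-return p a)
    q≤p : toℕ q ≤ toℕ p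
    q≤p = subst (λ z → toℕ q ≤ toℕ z) p≡ (isRepQ (subMod zero a))

  representatives : List (Fin N)
  representatives = filter isRepresentative? (allFin N)

  rep : Fin (length representatives) → Fin N
  rep = List.lookup representatives

  rep-isRepresentative : ∀ i → IsRepresentative (rep i)
  rep-isRepresentative i = proj₂ (∈-filter⁻ isRepresentative? {xs = allFin N} (∈-lookup i))

  representative∈ : ∀ p → representative p ∈ representatives
  representative∈ p = ∈-filter⁺ isRepresentative? (∈-allFin _) (representative-isRepresentative p)

  -- p lies in the orbit of its representative, at position - leastPosition p
  coord : Fin N → Fin (length representatives) × Fin (suc m)
  coord p = index (representative∈ p) , subMod zero (leastPosition p)

  rep-coord : ∀ p → rep (proj₁ (coord p)) ≡ representative p
  rep-coord p = sym (lookup-index (representative∈ p))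

  coord-sound : ∀ p → orbit (rep (proj₁ (coord p))) (proj₂ (coord p)) ≡ p
  coord-sound p = trans (cong (λ q → orbit q (subMod zero (leastPosition p))) (rep-coord p))
                        (orbit-return p (leastPosition p))

  coord-complete : ∀ i a → coord (orbit (rep i) a) ≡ (i , a)
  coord-complete i a = cong₂ _,_ sameIndex samePosition
    where
    p : Fin N
    p = orbit (rep i) a
    sameRepresentative : representative p ≡ rep i
    sameRepresentative = representative-unique (rep-isRepresentative i) (representative-isRepresentative p)
      (leastPosition p ⊕ toℕ a) (orbit-orbit (rep i) a (leastPosition p))
    sameIndex : index (representative∈ p) ≡ i
    sameIndex = unique⇒lookup-injective (filter⁺ isRepresentative? (allFin⁺ N)) _ _
      (trans (rep-coord p) sameRepresentative)
    samePosition : subMod zero (leastPosition p) ≡ a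
    samePosition = orbit-injective (rep i) (trans
      (cong (λ q → orbit q (subMod zero (leastPosition p))) (sym (trans (rep-coord p) sameRepresentative)))
      (coord-sound p))

  coordinates : BlockCoordinates (length representatives) (suc m) f
  coordinates = blockCoordinates f rep coord coord-sound coord-complete

orbitCoordinates : ∀ ρ m (f : Fin (ρ * suc m) → Fin (ρ * suc m)) →
  (∀ p → OrbitSize f p (suc m)) → BlockCoordinates ρ (suc m) f
orbitCoordinates ρ m f orbitSize = subst (λ R → BlockCoordinates R (suc m) f) (blockCount coordinates) coordinates
  where open OrbitDecomposition f orbitSize

-- Polycyclic configurations are blow-ups

iter-automorphism : ∀ {M N} (C : Matrix01 M N) (π : Permutation′ M) (τ : Permutation′ N) →
  IsAutomorphism C π τ → ∀ a p L → C (iter (π ⟨$⟩ʳ_) a p) (iter (τ ⟨$⟩ʳ_) a L) ≡ C p L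
iter-automorphism C π τ automorphism zero    p L = refl
iter-automorphism C π τ automorphism (suc a) p L =
  trans (automorphism _ _) (iter-automorphism C π τ automorphism a p L)

incidence-difference : ∀ {M N m} (C : Matrix01 M N) (π : Permutation′ M) (τ : Permutation′ N) →
  IsAutomorphism C π τ → (∀ L → iter (τ ⟨$⟩ʳ_) (suc m) L ≡ L) → ∀ x y (a b : Fin (suc m)) →
  C (iter (π ⟨$⟩ʳ_) (toℕ a) x) (iter (τ ⟨$⟩ʳ_) (toℕ b) y) ≡ C x (iter (τ ⟨$⟩ʳ_) (toℕ (subMod b a)) y)
incidence-difference {m = m} C π τ automorphism τ-period x y a b = begin
  C (iter (π ⟨$⟩ʳ_) (toℕ a) x) (orbit y b)                   ≡⟨ cong (C _) (sym b-via-difference) ⟩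
  C (iter (π ⟨$⟩ʳ_) (toℕ a) x) (orbit (orbit y (subMod b a)) a) ≡⟨ iter-automorphism C π τ automorphism (toℕ a) x _ ⟩
  C x (orbit y (subMod b a))                                  ∎
  where
  open Periodic (τ ⟨$⟩ʳ_) m τ-period
  b-via-difference : orbit (orbit y (subMod b a)) a ≡ orbit y b
  b-via-difference = trans (orbit-orbit y (subMod b a) a) (cong (orbit y) (⊕-subMod b a))

orbitScheme : ∀ {ρ σ m} (C : Matrix01 (ρ * suc m) (σ * suc m)) (τ : Permutation′ (σ * suc m)) →
  (Fin ρ → Fin (ρ * suc m)) → (Fin σ → Fin (σ * suc m)) → Scheme (suc m) ρ σ
orbitScheme C τ xs ys i j = tabulate (λ c → C (xs i) (iter (τ ⟨$⟩ʳ_) (toℕ c) (ys j)))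

relabel-orbitScheme : ∀ {ρ σ m} (C : Matrix01 (ρ * suc m) (σ * suc m))
  (π : Permutation′ (ρ * suc m)) (τ : Permutation′ (σ * suc m)) →
  IsAutomorphism C π τ → (∀ L → iter (τ ⟨$⟩ʳ_) (suc m) L ≡ L) →
  ((α , xs , _) : BlockCoordinates ρ (suc m) (π ⟨$⟩ʳ_)) → ((β , ys , _) : BlockCoordinates σ (suc m) (τ ⟨$⟩ʳ_)) →
  ∀ p L → C (α ⟨$⟩ʳ p) (β ⟨$⟩ʳ L) ≡ blowUp (orbitScheme C τ xs ys) p L
relabel-orbitScheme {ρ} {σ} {m} C π τ automorphism τ-period (α , xs , αc) (β , ys , βc) =
  by-blocks ρ (suc m) λ i a → by-blocks σ (suc m) λ j b → begin
    C (α ⟨$⟩ʳ combine i a) (β ⟨$⟩ʳ combine j b)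
      ≡⟨ cong₂ C (αc i a) (βc j b) ⟩
    C (iter (π ⟨$⟩ʳ_) (toℕ a) (xs i)) (iter (τ ⟨$⟩ʳ_) (toℕ b) (ys j))
      ≡⟨ incidence-difference C π τ automorphism τ-period (xs i) (ys j) a b ⟩
    C (xs i) (iter (τ ⟨$⟩ʳ_) (toℕ (subMod b a)) (ys j))
      ≡⟨ lookup∘tabulate (λ c → C (xs i) (iter (τ ⟨$⟩ʳ_) (toℕ c) (ys j))) (subMod b a) ⟨
    lookup (orbitScheme C τ xs ys i j) (subMod b a)
      ≡⟨ blowUp-combine (orbitScheme C τ xs ys) i a j b ⟨
    blowUp (orbitScheme C τ xs ys) (combine i a) (combine j b) ∎

polycyclic⇒scheme : ∀ {ρ σ k l m} (C : Matrix01 (ρ * suc m) (σ * suc m)) → IsConfiguration k l C →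
  Polycyclic C (suc m) →
  Σ (Permutation′ (ρ * suc m)) λ α → Σ (Permutation′ (σ * suc m)) λ β →
    Σ (Scheme (suc m) ρ σ) λ S → HasValency S k l × (∀ p L → C (α ⟨$⟩ʳ p) (β ⟨$⟩ʳ L) ≡ blowUp S p L)
polycyclic⇒scheme {ρ} {σ} {k} {l} {m} C (_ , rows , columns) (π , τ , automorphism , _ , orbitsπ , orbitsτ) =
  fromCoordinates (orbitCoordinates ρ m (π ⟨$⟩ʳ_) orbitsπ) (orbitCoordinates σ m (τ ⟨$⟩ʳ_) orbitsτ)
  where
  fromCoordinates : BlockCoordinates ρ (suc m) (π ⟨$⟩ʳ_) → BlockCoordinates σ (suc m) (τ ⟨$⟩ʳ_) →
    Σ (Permutation′ (ρ * suc m)) λ α → Σ (Permutation′ (σ * suc m)) λ β →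
      Σ (Scheme (suc m) ρ σ) λ S → HasValency S k l × (∀ p L → C (α ⟨$⟩ʳ p) (β ⟨$⟩ʳ L) ≡ blowUp S p L)
  fromCoordinates (α , xs , αc) (β , ys , βc) =
    α , β , orbitScheme C τ xs ys , valency-from-blowUp C α β (orbitScheme C τ xs ys) relabel rows columns , relabel
    where
    relabel : ∀ p L → C (α ⟨$⟩ʳ p) (β ⟨$⟩ʳ L) ≡ blowUp (orbitScheme C τ xs ys) p L
    relabel = relabel-orbitScheme C π τ automorphism (λ L → proj₁ (orbitsτ L)) (α , xs , αc) (β , ys , βc)

-- Blow-ups of schemes are polycyclic

scheme⇒polycyclic : ∀ {ρ σ m} → 0 < ρ → (C : Matrix01 (ρ * suc m) (σ * suc m))
  (α : Permutation′ (ρ * suc m)) (β : Permutation′ (σ * suc m)) (S : Scheme (suc m) ρ σ) →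
  (∀ p L → C (α ⟨$⟩ʳ p) (β ⟨$⟩ʳ L) ≡ blowUp S p L) → Polycyclic C (suc m)
scheme⇒polycyclic {ρ} {σ} {m} 0<ρ C α β S relabel =
  π , τ , automorphism , orbitSizes⇒order π τ (s≤s z≤n) point orbitsπ orbitsτ , orbitsπ , orbitsτ
  where
  module P = Blocks ρ m
  module L = Blocks σ m

  π : Permutation′ (ρ * suc m)
  π = conjugate α P.blockRotation

  τ : Permutation′ (σ * suc m)
  τ = conjugate β L.blockRotation

  orbitsπ : ∀ p → OrbitSize (π ⟨$⟩ʳ_) p (suc m)
  orbitsπ = orbitSize-conjugate α P.blockRotation P.blockRotation-orbitSize

  orbitsτ : ∀ L → OrbitSize (τ ⟨$⟩ʳ_) L (suc m)
  orbitsτ = orbitSize-conjugate β L.blockRotation L.blockRotation-orbitSize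

  point : Fin (ρ * suc m)
  point = combine (fromℕ< 0<ρ) zero

  automorphism : IsAutomorphism C π τ
  automorphism p L = begin
    C (α ⟨$⟩ʳ P.blockRotate 1 p′) (β ⟨$⟩ʳ L.blockRotate 1 L′)  ≡⟨ relabel _ _ ⟩
    blowUp S (P.blockRotate 1 p′) (L.blockRotate 1 L′)          ≡⟨ blowUp-blockRotate S 1 p′ L′ ⟩
    blowUp S p′ L′                                              ≡⟨ relabel p′ L′ ⟨
    C (α ⟨$⟩ʳ p′) (β ⟨$⟩ʳ L′)                                   ≡⟨ cong₂ C (inverseʳ α) (inverseʳ β) ⟩
    C p L                                                       ∎
    where
    p′ : Fin (ρ * suc m)
    p′ = α ⟨$⟩ˡ p
    L′ : Fin (σ * suc m)
    L′ = β ⟨$⟩ˡ L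

mainTheorem6 : (ρ σ k l μ : ℕ) → 0 < ρ → 0 < σ → 0 < k → 0 < l → 1 < μ →
    (C : Matrix01 (ρ * μ) (σ * μ)) → IsConfiguration k l C →
    Polycyclic C μ ⇔
      (Σ (Permutation′ (ρ * μ)) λ α → Σ (Permutation′ (σ * μ)) λ β →
        Σ (Scheme μ ρ σ) λ S → HasValency S k l ×
          (∀ p L → C (α ⟨$⟩ʳ p) (β ⟨$⟩ʳ L) ≡ blowUp S p L))
mainTheorem6 ρ σ k l (suc m) 0<ρ _ _ _ (s≤s _) C configuration =
  mk⇔ (polycyclic⇒scheme C configuration)
      (λ (α , β , S , _ , relabel) → scheme⇒polycyclic 0<ρ C α β S relabel)
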